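{- Let $A=\mathbb{Z}_2^n\times A_{2'}$, where $n\ge 1$ and $A_{2'}$ is a finite abelian group of odd order. Then a subgroup of $A$ is a subgroup perfect code of $A$ if and only if either the subgroup has even order or the subgroup is $A_{2'}$ (i.e. $\{0\}^n\times A_{2'}$).
   Context: Groups are written additively. An element $x\in A$ is a square if $x=2y$ for some $y\in A$; a subset is square-free if it contains no squares. For a square-free $T\subseteq A$, $\mathrm{CayS}(A,T)$ is the simple graph with vertex set $A$ where distinct $x,y$ are adjacent iff $x+y\in T$. A subset $C$ of vertices of a graph is a perfect code if every vertex is at distance at most one from exactly one vertex of $C$. A subgroup $H$ of $A$ is a subgroup perfect code of $A$ if $H$ is a perfect code of $\mathrm{CayS}(A,T)$ for some square-free $T\subseteq A$. -}

module Defs where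

open import Data.Bool using (Bool; true; false; _xor_; T)
open import Data.Nat using (ℕ)
open import Data.Fin using (Fin)
import Data.Vec as Vec
import Data.Bool
open import Data.Vec using (Vec; zipWith; replicate; allFin; toList)
open import Data.List using (List; length; filter; concatMap; map)
open import Data.Product using (_×_; _,_; proj₁; proj₂; ∃-syntax)
open import Relation.Binary.PropositionalEquality using (_≡_)
open import Relation.Nullary using (¬_)
open import Algebra.Structures using (IsAbelianGroup)
open import Function.Bundles using (_⇔_)
open import Data.Bool.Properties using (T?)

-- A finite abelian group, presented (up to isomorphism) on the carrier Fin m
-- with propositional equality.  Its order is m.
record FinAbGroup : Set where
  field
    order : ℕ
    _⊕_ : Fin order → Fin order → Fin order
    zero# : Fin order
    ⊖_ : Fin order → Fin order
    isAbelianGroup : IsAbelianGroup _≡_ _⊕_ zero# ⊖_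

open FinAbGroup public

allVecs : (n : ℕ) → List (Vec Bool n)
allVecs ℕ.zero = Data.List.[ Vec.[] ]

allVecs (ℕ.suc n) = concatMap (λ v → Data.List.[ Vec._∷_ false v ] Data.List.++ Data.List.[ Vec._∷_ true v ]) (allVecs n)


allFalse : ∀ {k} → Vec Bool k → Bool
allFalse Vec.[] = true
allFalse (b Vec.∷ w) = Data.Bool._∧_ (Data.Bool.not b) (allFalse w)


-- The group A = Z_2^n × G
module Ambient (n : ℕ) (G : FinAbGroup) where

  Elt : Set
  Elt = Vec Bool n × Fin (order G)

  infixl 6 _+A_
  _+A_ : Elt → Elt → Elt
  (u , a) +A (v , b) = zipWith _xor_ u v , _⊕_ G a b

  0A : Elt
  0A = replicate n false , zero# G

  -A_ : Elt → Elt
  -A (u , a) = u , ⊖_ G a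

  allElts : List Elt
  allElts = concatMap (λ u → map (λ a → u , a) (toList (allFin (order G)))) (allVecs n)

  Subset : Set
  Subset = Elt → Bool

  _∈_ : Elt → Subset → Set
  x ∈ S = T (S x)

  ∣_∣ : Subset → ℕ
  ∣ S ∣ = length (filter (λ x → T? (S x)) allElts)

  IsSubgroup : Subset → Set
  IsSubgroup H = (0A ∈ H)
               × (∀ x y → x ∈ H → y ∈ H → (x +A y) ∈ H)
               × (∀ x → x ∈ H → (-A x) ∈ H)

  IsSquare : Elt → Set
  IsSquare x = ∃[ y ] x ≡ y +A y

  SquareFree : Subset → Set
  SquareFree S = ∀ x → x ∈ S → ¬ IsSquare x

  -- adjacency in the Cayley sum graph CayS(A,T)
  Adj : Subset → Elt → Elt → Set
  Adj S x y = ¬ (x ≡ y) × ((x +A y) ∈ S)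

  Close : Subset → Elt → Elt → Set
  Close S x y = (x ≡ y) Data.Sum.⊎ Adj S x y
    where import Data.Sum

  IsPerfectCode : Subset → Subset → Set
  IsPerfectCode S C = ∀ v → ∃[ c ] ((c ∈ C × Close S v c)
                                    × (∀ c' → c' ∈ C → Close S v c' → c' ≡ c))

  IsSubgroupPerfectCode : Subset → Set
  IsSubgroupPerfectCode H = IsSubgroup H × ∃[ S ] (SquareFree S × IsPerfectCode S H)

  oddPart : Subset
  oddPart (u , a) = allFalse u

module Submission where

-- Parity is the engine.  A fixed-point-free involution preserving a predicate
-- on Fin m shows it holds an even number of times; in G this excludes elements
-- of order 2, so doubling is injective and (points being periodic under an
-- injective self-map of a finite set) every element of G is a double.  Hence
-- the squares of A are exactly {0}ⁿ × G, and (u , a) ∈ H gives (u , 0) ∈ H.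
-- Summing fibre sizes over Z₂ⁿ then shows: |H| is even iff H has an element
-- outside {0}ⁿ × G.  Forward: if |H| is odd, H ⊆ {0}ⁿ × G, and perfectness
-- forces equality because {0}ⁿ × G consists of squares.  Backward: every coset
-- v + H ≠ H meets A ∖ ({0}ⁿ × G), and choosing the first such element of each
-- coset (by search in allElts) gives a square-free connection set.

open import Defs
open import Algebra.Bundles using (AbelianGroup)
open import Data.Bool using (Bool; true; false; T; _∧_; not; _xor_; if_then_else_)
import Data.Bool as Bool
open import Data.Bool.Properties
  using (T?; ∧-identityʳ; xor-assoc; xor-comm; xor-identityˡ; xor-identityʳ; xor-same)
open import Data.Empty using (⊥-elim)
open import Data.Fin using (Fin; toℕ) renaming (zero to fzero; suc to fsuc)
open import Data.Fin.Properties using (pigeonhole) renaming (_≟_ to _≟ᶠ_)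
open import Data.List using (List; []; _∷_; _++_; length; filter; map; concatMap; findᵇ)
open import Data.List.Membership.Propositional using () renaming (_∈_ to _∈ₗ_)
open import Data.List.Membership.Propositional.Properties using (∈-concatMap⁺; ∈-map⁺)
open import Data.List.Properties using (filter-++; length-++; map-cong; map-++)
open import Data.List.Relation.Unary.Any using (here; there; any?)
import Data.List.Relation.Unary.Any as Any
open import Data.Maybe using (Maybe; just)
open import Data.Maybe.Properties using (just-injective) renaming (≡-dec to Maybe-≡-dec)
open import Data.Nat using (ℕ; zero; suc; _+_; _≥_)
open import Data.Nat.Divisibility
  using (_∣_; _∣?_; ∣-refl; _∣0; ∣m∣n⇒∣m+n; ∣m+n∣m⇒∣n; ∣1⇒≡1; n∣m*n)
open import Data.Nat.GeneralisedArithmetic using (iterate)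
open import Data.Nat.ListAction using (sum)
open import Data.Nat.ListAction.Properties using (sum-++)
open import Data.Nat.Properties
  using (+-comm; +-identityʳ; *-suc; *-identityʳ; n<1+n; m≤n⇒∃[o]m+o≡n; suc-injective)
open import Data.Nat.Tactic.RingSolver using (solve-∀)
open import Data.Product using (_×_; _,_; proj₁; proj₂; ∃-syntax)
open import Data.Product.Properties using () renaming (≡-dec to ×-≡-dec)
open import Data.Sum using (_⊎_; inj₁; inj₂)
open import Data.Unit using (tt)
import Data.Vec as Vec
open import Data.Vec using (Vec; []; _∷_; zipWith; replicate)
open import Data.Vec.Membership.Propositional.Properties using (∈-toList⁺; ∈-allFin⁺)
open import Data.Vec.Properties
  using (zipWith-assoc; zipWith-comm; zipWith-identityˡ; zipWith-identityʳ)
  renaming (≡-dec to Vec-≡-dec)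
open import Function.Bundles using (_⇔_; mk⇔)
open import Function.Definitions using (Injective)
open import Level using (0ℓ)
open import Relation.Binary.PropositionalEquality
open import Relation.Nullary using (¬_; Dec; yes; no; does; ¬?; _×-dec_)

count : {X : Set} → (X → Bool) → List X → ℕ
count p L = length (filter (λ x → T? (p x)) L)

count-++ : {X : Set} (p : X → Bool) (xs ys : List X) →
           count p (xs ++ ys) ≡ count p xs + count p ys
count-++ p xs ys =
  trans (cong length (filter-++ (λ x → T? (p x)) xs ys)) (length-++ (filter (λ x → T? (p x)) xs))

count-map : {X Y : Set} (p : Y → Bool) (f : X → Y) (L : List X) →
            count p (map f L) ≡ count (λ x → p (f x)) L
count-map p f [] = refl
count-map p f (x ∷ L) with p (f x)
... | true  = cong suc (count-map p f L)
... | false = count-map p f L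

count-concatMap : {X Y : Set} (p : Y → Bool) (g : X → List Y) (L : List X) →
                  count p (concatMap g L) ≡ sum (map (λ x → count p (g x)) L)
count-concatMap p g [] = refl
count-concatMap p g (x ∷ L) =
  trans (count-++ p (g x) (concatMap g L)) (cong (count p (g x) +_) (count-concatMap p g L))

findᵇ-sound : {X : Set} (p : X → Bool) (L : List X) {y : X} → findᵇ p L ≡ just y → T (p y)
findᵇ-sound p (x ∷ L) e with p x in px
findᵇ-sound p (x ∷ L) refl | true  = subst T (sym px) tt
...                        | false = findᵇ-sound p L e

findᵇ-complete : {X : Set} (p : X → Bool) {L : List X} {x : X} → x ∈ₗ L → T (p x) →
                 ∃[ y ] findᵇ p L ≡ just y
findᵇ-complete p {y ∷ L} x∈L px with p y in py
... | true = y , refl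
findᵇ-complete p {y ∷ L} (here refl) px  | false = ⊥-elim (subst T py px)
findᵇ-complete p {y ∷ L} (there x∈L) px  | false = findᵇ-complete p x∈L px

findᵇ-cong : {X : Set} {p q : X → Bool} → (∀ x → p x ≡ q x) → ∀ L → findᵇ p L ≡ findᵇ q L
findᵇ-cong p≗q []      = refl
findᵇ-cong {q = q} p≗q (x ∷ L) rewrite p≗q x with q x
... | true  = refl
... | false = findᵇ-cong p≗q L

T-ext : ∀ {a b} → (T a → T b) → (T b → T a) → a ≡ b
T-ext {false} {false} _ _ = refl
T-ext {false} {true}  _ g = ⊥-elim (g tt)
T-ext {true}  {false} f _ = ⊥-elim (f tt)
T-ext {true}  {true}  _ _ = refl

countᶠ : ∀ {m} → (Fin m → Bool) → ℕ
countᶠ {zero}  P = 0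
countᶠ {suc m} P = (if P fzero then 1 else 0) + countᶠ (λ i → P (fsuc i))

count-tabulate : {X : Set} {m : ℕ} (p : X → Bool) (f : Fin m → X) →
                 count p (Vec.toList (Vec.tabulate f)) ≡ countᶠ (λ i → p (f i))
count-tabulate {m = zero}  p f = refl
count-tabulate {m = suc m} p f with p (f fzero)
... | true  = cong suc (count-tabulate p (λ i → f (fsuc i)))
... | false = count-tabulate p (λ i → f (fsuc i))

countᶠ-cong : ∀ {m} {P Q : Fin m → Bool} → (∀ i → P i ≡ Q i) → countᶠ P ≡ countᶠ Q
countᶠ-cong {zero}  P≗Q = refl
countᶠ-cong {suc m} P≗Q =
  cong₂ _+_ (cong (λ b → if b then 1 else 0) (P≗Q fzero)) (countᶠ-cong (λ i → P≗Q (fsuc i)))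

countᶠ-all : ∀ m → countᶠ {m} (λ _ → true) ≡ m
countᶠ-all zero    = refl
countᶠ-all (suc m) = cong suc (countᶠ-all m)

countᶠ-none : ∀ {m} (P : Fin m → Bool) → (∀ i → P i ≡ false) → countᶠ P ≡ 0
countᶠ-none {zero}  P none = refl
countᶠ-none {suc m} P none rewrite none fzero = countᶠ-none (λ i → P (fsuc i)) (λ i → none (fsuc i))

countᶠ-witness : ∀ {m} (P : Fin m → Bool) {k} → countᶠ P ≡ suc k → ∃[ i ] T (P i)
countᶠ-witness {suc m} P e with P fzero in eq
... | true  = fzero , subst T (sym eq) tt
... | false = let i , Pi = countᶠ-witness (λ i → P (fsuc i)) e in fsuc i , Pi

_without_ : ∀ {m} → (Fin m → Bool) → Fin m → (Fin m → Bool)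
(P without x) y = P y ∧ not (does (y ≟ᶠ x))

countᶠ-without : ∀ {m} (P : Fin m → Bool) (x : Fin m) → T (P x) →
                 countᶠ P ≡ suc (countᶠ (P without x))
countᶠ-without {suc m} P fzero Px with P fzero
... | true = cong suc (countᶠ-cong (λ i → sym (∧-identityʳ (P (fsuc i)))))
countᶠ-without {suc m} P (fsuc x) Px with P fzero
... | true  = cong suc (countᶠ-without (λ i → P (fsuc i)) x Px)
... | false = countᶠ-without (λ i → P (fsuc i)) x Px

without⁺ : ∀ {m} (P : Fin m → Bool) {x y : Fin m} → T (P y) → y ≢ x → T ((P without x) y)
without⁺ P {x} {y} Py y≢x with P y | y ≟ᶠ x
... | true | no _    = tt
... | true | yes y≡x = y≢x y≡x

without⁻ : ∀ {m} (P : Fin m → Bool) {x y : Fin m} → T ((P without x) y) → T (P y) × y ≢ x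
without⁻ P {x} {y} t with P y | y ≟ᶠ x
... | true | no y≢x = tt , y≢x

-- A fixed-point-free involution σ of Fin m preserving P pairs off the
-- points satisfying P, so there is an even number of them.
module Involution {m} (σ : Fin m → Fin m) (σ-involutive : ∀ x → σ (σ x) ≡ x) where

  PairedBy : (Fin m → Bool) → Set
  PairedBy P = (∀ x → T (P x) → T (P (σ x))) × (∀ x → T (P x) → σ x ≢ x)

  remove-orbit : ∀ {P k} → PairedBy P → countᶠ P ≡ suc k →
                 ∃[ P′ ] PairedBy P′ × k ≡ suc (countᶠ P′)
  remove-orbit {P} (closed , free) e =
    P₂ , (closed₂ , free₂) , suc-injective (trans (sym e) count₂)
    where
    x  = proj₁ (countᶠ-witness P e)
    Px = proj₂ (countᶠ-witness P e)
    P₁ = P without x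
    P₂ = P₁ without σ x
    count₂ : countᶠ P ≡ suc (suc (countᶠ P₂))
    count₂ = trans (countᶠ-without P x Px)
                   (cong suc (countᶠ-without P₁ (σ x) (without⁺ P (closed x Px) (free x Px))))
    closed₂ : ∀ y → T (P₂ y) → T (P₂ (σ y))
    closed₂ y P₂y =
      let P₁y , y≢σx = without⁻ P₁ P₂y
          Py  , y≢x  = without⁻ P P₁y
      in without⁺ P₁ (without⁺ P (closed y Py)
                            (λ σy≡x → y≢σx (trans (sym (σ-involutive y)) (cong σ σy≡x))))
                  (λ σy≡σx → y≢x (trans (sym (σ-involutive y))
                                        (trans (cong σ σy≡σx) (σ-involutive x))))
    free₂ : ∀ y → T (P₂ y) → σ y ≢ y
    free₂ y P₂y = free y (proj₁ (without⁻ P (proj₁ (without⁻ P₁ P₂y))))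

  even-count : ∀ k {P} → countᶠ P ≡ k → PairedBy P → 2 ∣ k
  even-count zero          _ _      = 2 ∣0
  even-count (suc zero)    e paired with remove-orbit paired e
  ... | _ , _ , ()
  even-count (suc (suc k)) e paired with remove-orbit paired e
  ... | P′ , paired′ , e′ =
    ∣m∣n⇒∣m+n ∣-refl (even-count k (sym (suc-injective e′)) paired′)

  involution-even : ∀ {P} → PairedBy P → 2 ∣ countᶠ P
  involution-even = even-count _ refl

iterate-+ : {X : Set} (f : X → X) (x : X) (i j : ℕ) →
            iterate f x (i + j) ≡ iterate f (iterate f x i) j
iterate-+ f x zero    j = refl
iterate-+ f x (suc i) j = iterate-+ f (f x) i j

iterate-injective : {X : Set} {f : X → X} → Injective _≡_ _≡_ f →
                    ∀ k → Injective _≡_ _≡_ (λ x → iterate f x k)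
iterate-injective f-inj zero    e = e
iterate-injective f-inj (suc k) e = f-inj (iterate-injective f-inj k e)

-- Under an injective self-map of a finite set every point is periodic:
-- by pigeonhole two of b, f b, …, fᵐ b agree, and injectivity cancels.
periodic : ∀ {m} {f : Fin m → Fin m} → Injective _≡_ _≡_ f →
           ∀ b → ∃[ k ] iterate f b (suc k) ≡ b
periodic {m} {f} f-inj b with pigeonhole (n<1+n m) (λ i → iterate f b (toℕ i))
... | i , j , i<j , fⁱb≡fʲb with m≤n⇒∃[o]m+o≡n i<j
...   | k , i+1+k≡j = k , iterate-injective f-inj (toℕ i) (begin
  iterate f (iterate f b (suc k)) (toℕ i) ≡⟨ iterate-+ f b (suc k) (toℕ i) ⟨
  iterate f b (suc k + toℕ i)             ≡⟨ cong (iterate f b) (trans (cong suc (+-comm k (toℕ i))) i+1+k≡j) ⟩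
  iterate f b (toℕ j)                     ≡⟨ fⁱb≡fʲb ⟨
  iterate f b (toℕ i)                     ∎)
  where open ≡-Reasoning

-- Consequently a subset closed under an injective f contains b as soon as
-- it contains f b (b is recovered as an iterate of f b).
closed-preimage : ∀ {m} {f : Fin m → Fin m} → Injective _≡_ _≡_ f →
                  (K : Fin m → Set) → (∀ x → K x → K (f x)) →
                  ∀ b → K (f b) → K b
closed-preimage {f = f} f-inj K closed b Kfb =
  subst K (proj₂ (periodic f-inj b)) (iterates (proj₁ (periodic f-inj b)) (f b) Kfb)
  where
  iterates : ∀ k x → K x → K (iterate f x k)
  iterates zero    x Kx = Kx
  iterates (suc k) x Kx = iterates k (f x) (closed x Kx)

module OddOrder (G : FinAbGroup) (odd : ¬ 2 ∣ order G) where

  𝔾 : AbelianGroup 0ℓ 0ℓ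
  𝔾 = record { isAbelianGroup = isAbelianGroup G }

  open AbelianGroup 𝔾 using (_∙_; ε; _⁻¹; assoc; identityʳ; inverseʳ; commutativeSemigroup)
  open import Algebra.Properties.AbelianGroup 𝔾
    using (identityʳ-unique; ⁻¹-∙-comm; x∙y⁻¹≈ε⇒x≈y; x≈y⇒x∙y⁻¹≈ε)
  open import Algebra.Properties.CommutativeSemigroup commutativeSemigroup using (interchange)

  -- If t ≠ 0 and 2t = 0, translation by t would be a fixed-point-free
  -- involution of G, making the order of G even.
  no-involution : ∀ t → t ∙ t ≡ ε → t ≡ ε
  no-involution t 2t≡0 with t ≟ᶠ ε
  ... | yes t≡0 = t≡0
  ... | no  t≢0 = ⊥-elim (odd (subst (2 ∣_) (countᶠ-all (order G)) even))
    where
    open Involution (_∙ t) (λ x → trans (assoc x t t) (trans (cong (x ∙_) 2t≡0) (identityʳ x)))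
    even : 2 ∣ countᶠ {order G} (λ _ → true)
    even = involution-even ((λ _ _ → tt) , (λ x _ x+t≡x → t≢0 (identityʳ-unique x t x+t≡x)))

  -- 2(x - y) = 2x - 2y, so doubling is injective.
  double-injective : ∀ x y → x ∙ x ≡ y ∙ y → x ≡ y
  double-injective x y 2x≡2y = x∙y⁻¹≈ε⇒x≈y x y (no-involution (x ∙ y ⁻¹) (begin
    (x ∙ y ⁻¹) ∙ (x ∙ y ⁻¹) ≡⟨ interchange x (y ⁻¹) x (y ⁻¹) ⟩
    (x ∙ x) ∙ (y ⁻¹ ∙ y ⁻¹) ≡⟨ cong ((x ∙ x) ∙_) (⁻¹-∙-comm y y) ⟩
    (x ∙ x) ∙ (y ∙ y) ⁻¹    ≡⟨ x≈y⇒x∙y⁻¹≈ε 2x≡2y ⟩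
    ε                       ∎))
    where open ≡-Reasoning

  halving-closed : (K : Fin (order G) → Set) → (∀ x → K x → K (x ∙ x)) →
                   ∀ a → K (a ∙ a) → K a
  halving-closed = closed-preimage (λ {x} {y} → double-injective x y)

  -- Every element is a double (apply the above to the set of doubles).
  halve : ∀ b → ∃[ c ] c ∙ c ≡ b
  halve b = halving-closed (λ x → ∃[ c ] c ∙ c ≡ x)
                           (λ x (c , 2c≡x) → c ∙ c , cong₂ _∙_ 2c≡x 2c≡x) b (b , refl)

  self-inverse-zero : ∀ a → a ⁻¹ ≡ a → a ≡ ε
  self-inverse-zero a a⁻¹≡a = no-involution a (trans (cong (a ∙_) (sym a⁻¹≡a)) (inverseʳ a))

infixl 6 _⊻_
_⊻_ : ∀ {k} → Vec Bool k → Vec Bool k → Vec Bool k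
_⊻_ = zipWith _xor_

zeros : ∀ {k} → Vec Bool k
zeros = replicate _ false

⊻-assoc : ∀ {k} (u v w : Vec Bool k) → (u ⊻ v) ⊻ w ≡ u ⊻ (v ⊻ w)
⊻-assoc = zipWith-assoc xor-assoc

⊻-comm : ∀ {k} (u v : Vec Bool k) → u ⊻ v ≡ v ⊻ u
⊻-comm = zipWith-comm xor-comm

⊻-identityˡ : ∀ {k} (u : Vec Bool k) → zeros ⊻ u ≡ u
⊻-identityˡ = zipWith-identityˡ xor-identityˡ

⊻-identityʳ : ∀ {k} (u : Vec Bool k) → u ⊻ zeros ≡ u
⊻-identityʳ = zipWith-identityʳ xor-identityʳ

⊻-self : ∀ {k} (u : Vec Bool k) → u ⊻ u ≡ zeros
⊻-self []      = refl
⊻-self (b ∷ u) = cong₂ _∷_ (xor-same b) (⊻-self u)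

allFalse-zeros : ∀ k → T (allFalse (zeros {k}))
allFalse-zeros zero    = tt
allFalse-zeros (suc k) = allFalse-zeros k

allFalse⇒zeros : ∀ {k} (u : Vec Bool k) → T (allFalse u) → u ≡ zeros
allFalse⇒zeros []          _ = refl
allFalse⇒zeros (false ∷ u) e = cong (false ∷_) (allFalse⇒zeros u e)

⊻-cancelʳ : ∀ {k} (u w : Vec Bool k) → (u ⊻ w) ⊻ w ≡ u
⊻-cancelʳ u w = trans (⊻-assoc u w w) (trans (cong (u ⊻_) (⊻-self w)) (⊻-identityʳ u))

Σᵥ : ∀ k → (Vec Bool k → ℕ) → ℕ
Σᵥ zero    f = f []
Σᵥ (suc k) f = Σᵥ k (λ v → f (false ∷ v) + f (true ∷ v))

Σᵥ-cong : ∀ k {f g : Vec Bool k → ℕ} → (∀ v → f v ≡ g v) → Σᵥ k f ≡ Σᵥ k g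
Σᵥ-cong zero    f≗g = f≗g []
Σᵥ-cong (suc k) f≗g = Σᵥ-cong k (λ v → cong₂ _+_ (f≗g (false ∷ v)) (f≗g (true ∷ v)))

Σᵥ-+ : ∀ k (f g : Vec Bool k → ℕ) → Σᵥ k (λ v → f v + g v) ≡ Σᵥ k f + Σᵥ k g
Σᵥ-+ zero    f g = refl
Σᵥ-+ (suc k) f g =
  trans (Σᵥ-cong k (λ v → +-comm-middle (f (false ∷ v)) (g (false ∷ v)) (f (true ∷ v)) (g (true ∷ v))))
        (Σᵥ-+ k _ _)
  where
  +-comm-middle : ∀ a b c d → (a + b) + (c + d) ≡ (a + c) + (b + d)
  +-comm-middle = solve-∀

Σᵥ-translate : ∀ k (w : Vec Bool k) (f g : Vec Bool k → ℕ) →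
               (∀ v → f v ≡ g (v ⊻ w)) → Σᵥ k f ≡ Σᵥ k g
Σᵥ-translate zero    []          f g f≗g = f≗g []
Σᵥ-translate (suc k) (false ∷ w) f g f≗g =
  Σᵥ-translate k w _ _ (λ v → cong₂ _+_ (f≗g (false ∷ v)) (f≗g (true ∷ v)))
Σᵥ-translate (suc k) (true ∷ w)  f g f≗g =
  Σᵥ-translate k w _ _ (λ v → trans (cong₂ _+_ (f≗g (false ∷ v)) (f≗g (true ∷ v)))
                                    (+-comm (g (true ∷ (v ⊻ w))) (g (false ∷ (v ⊻ w)))))

2∣n+n : ∀ n → 2 ∣ n + n
2∣n+n n = subst (2 ∣_) (trans (*-suc n 1) (cong (n +_) (*-identityʳ n))) (n∣m*n n)

-- If f is invariant under translation by a nonzero w, its sum is even: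
-- translation by w pairs the points of Z₂ⁿ.
Σᵥ-even : ∀ k (w : Vec Bool k) (f : Vec Bool k → ℕ) → ¬ T (allFalse w) →
          (∀ v → f v ≡ f (v ⊻ w)) → 2 ∣ Σᵥ k f
Σᵥ-even zero    []          f w≢0 _ = ⊥-elim (w≢0 tt)
Σᵥ-even (suc k) (false ∷ w) f w≢0 f≗f∘+w =
  Σᵥ-even k w _ w≢0 (λ v → cong₂ _+_ (f≗f∘+w (false ∷ v)) (f≗f∘+w (true ∷ v)))
Σᵥ-even (suc k) (true ∷ w)  f _   f≗f∘+w =
  subst (2 ∣_) (sym (trans (Σᵥ-+ k _ _) (cong (Σᵥ k (λ v → f (false ∷ v)) +_) (sym halves-equal))))
        (2∣n+n (Σᵥ k (λ v → f (false ∷ v))))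
  where
  halves-equal : Σᵥ k (λ v → f (false ∷ v)) ≡ Σᵥ k (λ v → f (true ∷ v))
  halves-equal = Σᵥ-translate k w _ _ (λ v → f≗f∘+w (false ∷ v))

Σᵥ-single : ∀ k (f : Vec Bool k → ℕ) → (∀ v → ¬ T (allFalse v) → f v ≡ 0) →
            Σᵥ k f ≡ f zeros
Σᵥ-single zero    f _      = refl
Σᵥ-single (suc k) f f0-off =
  trans (Σᵥ-single k _ (λ v v≢0 → cong₂ _+_ (f0-off (false ∷ v) v≢0) (f0-off (true ∷ v) λ ())))
        (trans (cong (f (false ∷ zeros) +_) (f0-off (true ∷ zeros) λ ())) (+-identityʳ _))

sum-map-concatMap : {X Y : Set} (h : Y → ℕ) (g : X → List Y) (L : List X) →
                    sum (map h (concatMap g L)) ≡ sum (map (λ x → sum (map h (g x))) L)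
sum-map-concatMap h g []      = refl
sum-map-concatMap h g (x ∷ L) = begin
  sum (map h (g x ++ concatMap g L))              ≡⟨ cong sum (map-++ h (g x) (concatMap g L)) ⟩
  sum (map h (g x) ++ map h (concatMap g L))      ≡⟨ sum-++ (map h (g x)) _ ⟩
  sum (map h (g x)) + sum (map h (concatMap g L)) ≡⟨ cong (sum (map h (g x)) +_) (sum-map-concatMap h g L) ⟩
  sum (map h (g x)) + sum (map (λ y → sum (map h (g y))) L) ∎
  where open ≡-Reasoning

sum-allVecs : ∀ k (h : Vec Bool k → ℕ) → sum (map h (allVecs k)) ≡ Σᵥ k h
sum-allVecs zero    h = +-identityʳ (h [])
sum-allVecs (suc k) h =
  trans (sum-map-concatMap h _ (allVecs k))
        (trans (sum-allVecs k _) (Σᵥ-cong k (λ v → cong (h (false ∷ v) +_) (+-identityʳ (h (true ∷ v))))))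

¬2∣suc-even : ∀ {k} → 2 ∣ k → ¬ 2 ∣ suc k
¬2∣suc-even {k} 2∣k 2∣1+k with ∣1⇒≡1 (∣m+n∣m⇒∣n (subst (2 ∣_) (+-comm 1 k) 2∣1+k) 2∣k)
... | ()

module Setting (n : ℕ) (G : FinAbGroup) (odd : ¬ 2 ∣ order G) where

  open Ambient n G
  open OddOrder G odd using (𝔾; halve; halving-closed; self-inverse-zero)
  open AbelianGroup 𝔾 using (_∙_; ε; _⁻¹)
    renaming (assoc to ∙-assoc; comm to ∙-comm; identityˡ to ∙-identityˡ;
              identityʳ to ∙-identityʳ; inverseˡ to ∙-inverseˡ; inverseʳ to ∙-inverseʳ)
  open import Algebra.Properties.AbelianGroup 𝔾 using (⁻¹-involutive; ε⁻¹≈ε; ⁻¹-injective)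

  𝔸 : AbelianGroup 0ℓ 0ℓ
  𝔸 = record
    { Carrier = Elt ; _≈_ = _≡_ ; _∙_ = _+A_ ; ε = 0A ; _⁻¹ = -A_
    ; isAbelianGroup = record
      { isGroup = record
        { isMonoid = record
          { isSemigroup = record
            { isMagma = record { isEquivalence = isEquivalence ; ∙-cong = cong₂ _+A_ }
            ; assoc = λ (u , a) (v , b) (w , c) → cong₂ _,_ (⊻-assoc u v w) (∙-assoc a b c) }
          ; identity = (λ (u , a) → cong₂ _,_ (⊻-identityˡ u) (∙-identityˡ a))
                     , (λ (u , a) → cong₂ _,_ (⊻-identityʳ u) (∙-identityʳ a)) }
        ; inverse = (λ (u , a) → cong₂ _,_ (⊻-self u) (∙-inverseˡ a))
                  , (λ (u , a) → cong₂ _,_ (⊻-self u) (∙-inverseʳ a))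
        ; ⁻¹-cong = cong -A_ }
      ; comm = λ (u , a) (v , b) → cong₂ _,_ (⊻-comm u v) (∙-comm a b) } }

  open AbelianGroup 𝔸 using ()
    renaming (assoc to +A-assoc; identityˡ to +A-identityˡ; inverseˡ to +A-inverseˡ; inverseʳ to +A-inverseʳ)
  open import Algebra.Properties.AbelianGroup 𝔸 using ()
    renaming (xyx⁻¹≈y to x+y-x≡y; ⁻¹-anti-homo‿- to -A-anti; ∙-cancelˡ to +A-cancelˡ)

  infixl 6 _-A_
  _-A_ : Elt → Elt → Elt
  x -A y = x +A (-A y)

  telescope : ∀ x y z → (x -A y) +A (y -A z) ≡ x -A z
  telescope x y z = begin
    (x -A y) +A (y -A z)      ≡⟨ +A-assoc x (-A y) (y -A z) ⟩
    x +A (-A y +A (y -A z))   ≡⟨ cong (x +A_) (+A-assoc (-A y) y (-A z)) ⟨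
    x +A ((-A y +A y) -A z)   ≡⟨ cong (λ e → x +A (e -A z)) (+A-inverseˡ y) ⟩
    x +A (0A -A z)            ≡⟨ cong (x +A_) (+A-identityˡ (-A z)) ⟩
    x -A z                    ∎
    where open ≡-Reasoning

  -- The squares of A are exactly the elements of {0}ⁿ × G: the Z₂ⁿ-part of
  -- y + y is y₁ ⊻ y₁ = 0, and every element of G is a double.
  square⇒oddPart : ∀ x → IsSquare x → x ∈ oddPart
  square⇒oddPart x (y , refl) = subst (λ u → T (allFalse u)) (sym (⊻-self (proj₁ y))) (allFalse-zeros n)

  oddPart⇒square : ∀ x → x ∈ oddPart → IsSquare x
  oddPart⇒square (u , a) u-zero =
    let c , c∙c≡a = halve a
    in (zeros , c) , cong₂ _,_ (trans (allFalse⇒zeros u u-zero) (sym (⊻-self zeros))) (sym c∙c≡a)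

  allVecs-complete : ∀ {k} (u : Vec Bool k) → u ∈ₗ allVecs k
  allVecs-complete []          = here refl
  allVecs-complete (false ∷ u) = ∈-concatMap⁺ _ (Any.map (λ { refl → here refl }) (allVecs-complete u))
  allVecs-complete (true ∷ u)  = ∈-concatMap⁺ _ (Any.map (λ { refl → there (here refl) }) (allVecs-complete u))

  allElts-complete : ∀ x → x ∈ₗ allElts
  allElts-complete (u , a) =
    ∈-concatMap⁺ _ (Any.map (λ { refl → ∈-map⁺ (u ,_) (∈-toList⁺ (∈-allFin⁺ a)) }) (allVecs-complete u))

  fibre : Subset → Vec Bool n → ℕ
  fibre S u = countᶠ (λ a → S (u , a))

  card-fibres : ∀ S → ∣ S ∣ ≡ Σᵥ n (fibre S)
  card-fibres S = begin
    count S allElts                                       ≡⟨ count-concatMap S _ (allVecs n) ⟩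
    sum (map (λ u → count S (map (u ,_) Gs)) (allVecs n)) ≡⟨ cong sum (map-cong count-fibre (allVecs n)) ⟩
    sum (map (fibre S) (allVecs n))                       ≡⟨ sum-allVecs n (fibre S) ⟩
    Σᵥ n (fibre S)                                        ∎
    where
    open ≡-Reasoning
    Gs = Vec.toList (Vec.allFin (order G))
    count-fibre : ∀ u → count S (map (u ,_) Gs) ≡ fibre S u
    count-fibre u = trans (count-map S (u ,_) Gs) (count-tabulate (λ a → S (u , a)) (λ a → a))

  module Subgroup (H : Subset) (H-subgroup : IsSubgroup H) where

    0∈H : 0A ∈ H
    0∈H = proj₁ H-subgroup

    +-closed : ∀ {x y} → x ∈ H → y ∈ H → (x +A y) ∈ H
    +-closed = proj₁ (proj₂ H-subgroup) _ _

    neg-closed : ∀ {x} → x ∈ H → (-A x) ∈ H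
    neg-closed = proj₂ (proj₂ H-subgroup) _

    -closed : ∀ {x y} → x ∈ H → y ∈ H → (x -A y) ∈ H
    -closed x∈H y∈H = +-closed x∈H (neg-closed y∈H)

    -- If (u , a) ∈ H then (u , 0) ∈ H: the elements g with (0 , g) ∈ H form a
    -- set closed under doubling that contains 2a, hence contains a.
    drop-G-part : ∀ {u a} → (u , a) ∈ H → (u , ε) ∈ H
    drop-G-part {u} {a} ua∈H =
      subst (_∈ H) (cong₂ _,_ (⊻-identityʳ u) (∙-inverseʳ a)) (-closed ua∈H 0a∈H)
      where
      K : Fin (order G) → Set
      K g = (zeros , g) ∈ H
      double : ∀ {v g} → (v , g) ∈ H → K (g ∙ g)
      double {v} {g} vg∈H = subst (λ w → (w , g ∙ g) ∈ H) (⊻-self v) (+-closed vg∈H vg∈H)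
      0a∈H : K a
      0a∈H = halving-closed K (λ g → double) a (double ua∈H)

    -- A subgroup with an element outside {0}ⁿ × G has even order: if
    -- (w , 0) ∈ H with w ≠ 0, translation by w preserves the fibre sizes.
    escape⇒even : ∀ x → x ∈ H → ¬ x ∈ oddPart → 2 ∣ ∣ H ∣
    escape⇒even (w , a) wa∈H w≢0 =
      subst (2 ∣_) (sym (card-fibres H)) (Σᵥ-even n w (fibre H) w≢0 fibre-invariant)
      where
      w0∈H : (w , ε) ∈ H
      w0∈H = drop-G-part wa∈H
      shift : ∀ {v b} → (v , b) ∈ H → (v ⊻ w , b) ∈ H
      shift {v} {b} vb∈H = subst (λ g → (v ⊻ w , g) ∈ H) (∙-identityʳ b) (+-closed vb∈H w0∈H)
      fibre-invariant : ∀ v → fibre H v ≡ fibre H (v ⊻ w)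
      fibre-invariant v = countᶠ-cong (λ b →
        T-ext shift (λ vwb∈H → subst (λ u → (u , b) ∈ H) (⊻-cancelʳ v w) (shift vwb∈H)))

    -- A subgroup inside {0}ⁿ × G has odd order: it is {0}ⁿ × K, and negation
    -- pairs off the nonzero elements of K (no element of G has order 2).
    inside⇒odd : (∀ x → x ∈ H → x ∈ oddPart) → ¬ 2 ∣ ∣ H ∣
    inside⇒odd H⊆oddPart 2∣H = ¬2∣suc-even nonzero-even (subst (2 ∣_) order-odd 2∣H)
      where
      K : Fin (order G) → Bool
      K a = H (zeros , a)
      empty-off-zero : ∀ v → ¬ T (allFalse v) → fibre H v ≡ 0
      empty-off-zero v v≢0 =
        countᶠ-none (λ a → H (v , a)) (λ a → T-ext (λ va∈H → ⊥-elim (v≢0 (H⊆oddPart (v , a) va∈H))) λ ())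
      order-odd : ∣ H ∣ ≡ suc (countᶠ (K without ε))
      order-odd = begin
        ∣ H ∣                      ≡⟨ card-fibres H ⟩
        Σᵥ n (fibre H)             ≡⟨ Σᵥ-single n (fibre H) empty-off-zero ⟩
        countᶠ K                   ≡⟨ countᶠ-without K ε 0∈H ⟩
        suc (countᶠ (K without ε)) ∎
        where open ≡-Reasoning
      open Involution _⁻¹ ⁻¹-involutive
      nonzero-even : 2 ∣ countᶠ (K without ε)
      nonzero-even = involution-even
        ( (λ a Ka′ → let Ka , a≢0 = without⁻ K Ka′
                     in without⁺ K (neg-closed Ka) (λ a⁻¹≡0 → a≢0 (⁻¹-injective (trans a⁻¹≡0 (sym ε⁻¹≈ε)))))
        , (λ a Ka′ a⁻¹≡a → proj₂ (without⁻ K Ka′) (self-inverse-zero a a⁻¹≡a)) )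

    odd⇒inside : ¬ 2 ∣ ∣ H ∣ → ∀ x → x ∈ H → x ∈ oddPart
    odd⇒inside odd-order x x∈H with T? (oddPart x)
    ... | yes x∈oddPart = x∈oddPart
    ... | no  x∉oddPart = ⊥-elim (odd-order (escape⇒even x x∈H x∉oddPart))

    even⇒escape : 2 ∣ ∣ H ∣ → ∃[ x ] x ∈ H × ¬ x ∈ oddPart
    even⇒escape even-order
      with any? (λ x → T? (H x) ×-dec ¬? (T? (oddPart x))) allElts
    ... | yes found = Any.satisfied found
    ... | no  none  = ⊥-elim (inside⇒odd inside even-order)
      where
      inside : ∀ x → x ∈ H → x ∈ oddPart
      inside x x∈H with T? (oddPart x)
      ... | yes x∈oddPart = x∈oddPart
      ... | no  x∉oddPart = ⊥-elim (none (Any.map (λ { refl → x∈H , x∉oddPart }) (allElts-complete x)))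

    -- y is a candidate representative for the coset v + H: it lies in that
    -- coset and outside {0}ⁿ × G (so it is not a square).
    Candidate : Elt → Elt → Bool
    Candidate v y = H (y -A v) ∧ not (oddPart y)

    candidate⁻ : ∀ {v y} → T (Candidate v y) → (y -A v) ∈ H × ¬ y ∈ oddPart
    candidate⁻ {v} {y} Cy with H (y -A v) | oddPart y
    ... | true | false = tt , λ ()

    candidate⁺ : ∀ {v y} → (y -A v) ∈ H → ¬ y ∈ oddPart → T (Candidate v y)
    candidate⁺ {v} {y} y-v∈H y∉oddPart with H (y -A v) | oddPart y
    ... | true  | false = tt
    ... | true  | true  = y∉oddPart tt

    rep : Elt → Maybe Elt
    rep v = findᵇ (Candidate v) allElts

    rep-coset : ∀ {v w} → (w -A v) ∈ H → rep v ≡ rep w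
    rep-coset {v} {w} w-v∈H = findᵇ-cong (λ y → cong (_∧ not (oddPart y)) (T-ext to from)) allElts
      where
      to : ∀ {y} → (y -A v) ∈ H → (y -A w) ∈ H
      to {y} y-v∈H = subst (_∈ H) (telescope y v w) (+-closed y-v∈H (subst (_∈ H) (-A-anti w v) (neg-closed w-v∈H)))
      from : ∀ {y} → (y -A w) ∈ H → (y -A v) ∈ H
      from {y} y-w∈H = subst (_∈ H) (telescope y w v) (+-closed y-w∈H w-v∈H)

    _≟ᴬ_ : (x y : Elt) → Dec (x ≡ y)
    _≟ᴬ_ = ×-≡-dec (Vec-≡-dec Bool._≟_) _≟ᶠ_

    -- The connection set: the chosen representatives of the cosets other than H.
    Conn : Subset
    Conn t = not (H t) ∧ does (Maybe-≡-dec _≟ᴬ_ (rep t) (just t))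

    conn⁻ : ∀ {t} → t ∈ Conn → ¬ t ∈ H × rep t ≡ just t
    conn⁻ {t} t∈Conn with H t | Maybe-≡-dec _≟ᴬ_ (rep t) (just t)
    ... | false | yes rep-t≡t = (λ ()) , rep-t≡t

    conn⁺ : ∀ {t} → ¬ t ∈ H → rep t ≡ just t → t ∈ Conn
    conn⁺ {t} t∉H rep-t≡t with H t | Maybe-≡-dec _≟ᴬ_ (rep t) (just t)
    ... | true  | _   = t∉H tt
    ... | false | yes _ = tt
    ... | false | no rep-t≢t = rep-t≢t rep-t≡t

    -- A representative is a candidate for its own coset, hence not a square.
    Conn-squareFree : SquareFree Conn
    Conn-squareFree t t∈Conn t-square =
      proj₂ (candidate⁻ (findᵇ-sound (Candidate t) allElts (proj₂ (conn⁻ t∈Conn))))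
            (square⇒oddPart t t-square)

    -- If every coset other than H has a candidate, H is a perfect code of
    -- CayS(A, Conn): v ∈ H is only close to itself (Conn ∩ H = ∅), and
    -- v ∉ H is adjacent to c ∈ H iff v + c is the representative of v + H.
    Conn-perfect : (∀ v → ¬ v ∈ H → ∃[ y ] T (Candidate v y)) → IsPerfectCode Conn H
    Conn-perfect meets v with T? (H v)
    ... | yes v∈H = v , (v∈H , inj₁ refl) , unique
      where
      unique : ∀ c → c ∈ H → Close Conn v c → c ≡ v
      unique c _   (inj₁ v≡c)            = sym v≡c
      unique c c∈H (inj₂ (_ , v+c∈Conn)) = ⊥-elim (proj₁ (conn⁻ v+c∈Conn) (+-closed v∈H c∈H))
    ... | no v∉H =
      let z , Cz      = meets v v∉H
          y , rep-v≡y = findᵇ-complete (Candidate v) (allElts-complete z) Cz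
      in neighbour y rep-v≡y
      where
      neighbour : ∀ y → rep v ≡ just y →
                  ∃[ c ] ((c ∈ H × Close Conn v c) × (∀ c′ → c′ ∈ H → Close Conn v c′ → c′ ≡ c))
      neighbour y rep-v≡y = y -A v , (c∈H , inj₂ (v≢c , subst (_∈ Conn) (sym v+c≡y) y∈Conn)) , unique
        where
        c∈H : (y -A v) ∈ H
        c∈H = proj₁ (candidate⁻ (findᵇ-sound (Candidate v) allElts rep-v≡y))
        v+c≡y : v +A (y -A v) ≡ y
        v+c≡y = trans (sym (+A-assoc v y (-A v))) (x+y-x≡y v y)
        v≢c : v ≢ y -A v
        v≢c v≡c = v∉H (subst (_∈ H) (sym v≡c) c∈H)
        y∉H : ¬ y ∈ H
        y∉H y∈H = v∉H (subst (_∈ H) y-c≡v (-closed y∈H c∈H))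
          where
          y-c≡v : y -A (y -A v) ≡ v
          y-c≡v = trans (cong (y +A_) (-A-anti y v)) (trans (sym (+A-assoc y v (-A y))) (x+y-x≡y y v))
        y∈Conn : y ∈ Conn
        y∈Conn = conn⁺ y∉H (trans (sym (rep-coset c∈H)) rep-v≡y)
        unique : ∀ c′ → c′ ∈ H → Close Conn v c′ → c′ ≡ y -A v
        unique c′ c′∈H (inj₁ v≡c′)             = ⊥-elim (v∉H (subst (_∈ H) (sym v≡c′) c′∈H))
        unique c′ c′∈H (inj₂ (_ , v+c′∈Conn)) = +A-cancelˡ v c′ (y -A v) (trans v+c′≡y (sym v+c≡y))
          where
          v+c′≡y : v +A c′ ≡ y
          v+c′≡y = just-injective (begin
            just (v +A c′) ≡⟨ proj₂ (conn⁻ v+c′∈Conn) ⟨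
            rep (v +A c′)  ≡⟨ rep-coset (subst (_∈ H) (sym (x+y-x≡y v c′)) c′∈H) ⟨
            rep v          ≡⟨ rep-v≡y ⟩
            just y         ∎)
            where open ≡-Reasoning

    -- When H has even order, or H = {0}ⁿ × G, every coset other than H has a
    -- candidate: v itself if v ∉ {0}ⁿ × G, and otherwise v + x for an element
    -- x ∈ H outside {0}ⁿ × G.
    cosets-meet : 2 ∣ ∣ H ∣ ⊎ (∀ x → H x ≡ oddPart x) →
                  ∀ v → ¬ v ∈ H → ∃[ y ] T (Candidate v y)
    cosets-meet cases v v∉H with T? (oddPart v)
    ... | no v∉oddPart = v , candidate⁺ (subst (_∈ H) (sym (+A-inverseʳ v)) 0∈H) v∉oddPart
    ... | yes v∈oddPart with cases
    ...   | inj₂ H≡oddPart = ⊥-elim (v∉H (subst T (sym (H≡oddPart v)) v∈oddPart))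
    ...   | inj₁ even-order =
      let x , x∈H , x∉oddPart = even⇒escape even-order
      in v +A x , candidate⁺ (subst (_∈ H) (sym (x+y-x≡y v x)) x∈H)
                             (λ v+x∈oddPart → x∉oddPart (subst (λ u → T (allFalse u))
                                (trans (cong (_⊻ proj₁ x) (allFalse⇒zeros (proj₁ v) v∈oddPart)) (⊻-identityˡ (proj₁ x)))
                                v+x∈oddPart))

    -- Conversely, if H ⊆ {0}ⁿ × G is a perfect code of CayS(A, S) with S
    -- square-free, then H = {0}ⁿ × G: a vertex x ∈ {0}ⁿ × G outside H would be
    -- adjacent to some c ∈ H, and x + c ∈ S would lie in {0}ⁿ × G, i.e. be a square.
    perfect-inside⇒oddPart : ∀ S → SquareFree S → IsPerfectCode S H →
                             (∀ x → x ∈ H → x ∈ oddPart) → ∀ x → H x ≡ oddPart x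
    perfect-inside⇒oddPart S S-squareFree H-perfect H⊆oddPart x = T-ext (H⊆oddPart x) oddPart⊆H
      where
      oddPart⊆H : x ∈ oddPart → x ∈ H
      oddPart⊆H x∈oddPart with T? (H x) | H-perfect x
      ... | yes x∈H | _ = x∈H
      ... | no  _   | c , (c∈H , inj₁ x≡c) , _ = subst (_∈ H) (sym x≡c) c∈H
      ... | no  _   | c , (c∈H , inj₂ (_ , x+c∈S)) , _ =
        ⊥-elim (S-squareFree (x +A c) x+c∈S (oddPart⇒square (x +A c) x+c∈oddPart))
        where
        x+c∈oddPart : (x +A c) ∈ oddPart
        x+c∈oddPart = subst (λ u → T (allFalse u))
          (sym (trans (cong₂ _⊻_ (allFalse⇒zeros (proj₁ x) x∈oddPart) (allFalse⇒zeros (proj₁ c) (H⊆oddPart c c∈H)))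
                      (⊻-self zeros)))
          (allFalse-zeros n)

proposition3p10 : (n : ℕ) → n ≥ 1 → (G : FinAbGroup) → ¬ (2 ∣ order G) →
    (H : Ambient.Subset n G) → Ambient.IsSubgroup n G H →
    Ambient.IsSubgroupPerfectCode n G H
      ⇔ ((2 ∣ Ambient.∣_∣ n G H) ⊎ (∀ x → H x ≡ Ambient.oddPart n G x))
proposition3p10 n _ G odd H H-subgroup = mk⇔ forward backward
  where
  open Ambient n G
  open Setting n G odd
  open Subgroup H H-subgroup

  forward : IsSubgroupPerfectCode H → 2 ∣ ∣ H ∣ ⊎ (∀ x → H x ≡ oddPart x)
  forward (_ , S , S-squareFree , H-perfect) with 2 ∣? ∣ H ∣
  ... | yes even-order = inj₁ even-order
  ... | no  odd-order  = inj₂ (perfect-inside⇒oddPart S S-squareFree H-perfect (odd⇒inside odd-order))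

  backward : 2 ∣ ∣ H ∣ ⊎ (∀ x → H x ≡ oddPart x) → IsSubgroupPerfectCode H
  backward cases = H-subgroup , Conn , Conn-squareFree , Conn-perfect (cosets-meet cases)
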